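{- Let $e=(u_1,u_2)$ be a right edge in $T$ whose minimal mincut is $u_e^\downarrow\setminus l_e^\downarrow$, let $\textsc{lca}_e=\mathrm{LCA}(u_1,u_2)$ and $x_e=\mathrm{LCA}(l_e,\textsc{lca}_e)$. For any vertex $u$ define $Y_{e,u}=[u_1,u_2]\cup[u,\textsc{lca}_e]$. Then for every vertex $u\in[x_e,\textsc{lca}_e]\setminus\{x_e\}$ we have $\mathrm{top}(L_u\setminus Y_{e,u})=\emptyset$.
   Context: $G=(V,E,w)$ is an undirected graph with nonnegative weights, root $r$, and $T$ a spanning tree rooted at $r$; LCA is taken in $T$. For a vertex $v$, $v^\downarrow$ ($v^\Downarrow$) is the set of descendants (strict descendants) of $v$ in $T$, and $v^\uparrow$ ($v^\Uparrow$) the set of ancestors (strict ancestors), where $v$ is its own ancestor and descendant. Cuts are identified with the side not containing $r$; size is the number of vertices; a mincut is a cut of minimum weight. The minimal mincut of an edge is the least-size mincut containing both endpoints. A comparable $2$-respecting mincut is a mincut $w^\downarrow\setminus v^\downarrow$ with $v\in w^\Downarrow$ (lower vertex $v$, upper vertex $w$). An edge is a right edge in $T$ if its minimal mincut exists and is a comparable $2$-respecting mincut. For each vertex $v$, $H(v)$ is the highest vertex $w\in v^\Uparrow$ such that $w^\downarrow\setminus v^\downarrow$ is a mincut, or $\mathsf{null}$ if none. For a vertex $u$, $L_u=\{v\in u^\Downarrow : H(v)\neq\mathsf{null},\ H(v)\in u^\uparrow\}$. For $S\subseteq V$, $\mathrm{top}(S)$ is the set of $v\in S$ such that no vertex of $S$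 lies in $v^\Uparrow$. $[a,b]$ denotes the set of vertices on the tree path between $a$ and $b$.
   Formalization: The edge weights of G are nonnegative rationals. -}

module Defs where

open import Data.Nat as ℕ using (ℕ; zero; suc)
open import Data.Fin using (Fin)
open import Data.Fin.Subset using (Subset; _∈_; _∉_; ∣_∣; Nonempty)
open import Data.Vec using (lookup)
open import Data.Bool using (Bool; true; false; _xor_; if_then_else_)
open import Data.List using (List; foldr)
open import Data.List.Membership.Propositional using () renaming (_∈_ to _∈ₗ_)
open import Data.Product using (Σ; ∃; _×_; _,_; proj₁; proj₂)
open import Data.Sum using (_⊎_)
open import Data.Rational using (ℚ; 0ℚ) renaming (_+_ to _+ℚ_; _≤_ to _≤ℚ_)
open import Function using (_⇔_; _∘_)
open import Relation.Nullary using (¬_)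
open import Relation.Binary.PropositionalEquality using (_≡_; _≢_)

-- Weighted undirected (multi)graph on vertex set Fin n.
-- An edge is an unordered pair of endpoints (stored as an ordered pair)
-- together with a nonnegative rational weight.
record Graph (n : ℕ) : Set where
  field
    edges     : List ((Fin n × Fin n) × ℚ)
    weight≥0  : ∀ {e} → e ∈ₗ edges → 0ℚ ≤ℚ proj₂ e

open Graph public

IsEdge : ∀ {n} → Graph n → Fin n → Fin n → Set
IsEdge G a b = ∃ λ c → (((a , b) , c) ∈ₗ edges G) ⊎ (((b , a) , c) ∈ₗ edges G)

cutWeight : ∀ {n} → Graph n → Subset n → ℚ
cutWeight G S = foldr step 0ℚ (edges G)
  where
  step : _ → ℚ → ℚ
  step ((a , b) , c) acc =
    if lookup S a xor lookup S b then c +ℚ acc else acc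

iter : ∀ {A : Set} → (A → A) → A → ℕ → A
iter f x zero = x
iter f x (suc k) = f (iter f x k)

record RootedSpanningTree {n : ℕ} (G : Graph n) : Set where
  field
    root       : Fin n
    parent     : Fin n → Fin n
    parent-root : parent root ≡ root
    reaches-root : ∀ v → ∃ λ k → iter parent v k ≡ root
    tree-edges : ∀ v → v ≢ root → IsEdge G v (parent v)

open RootedSpanningTree public

module _ {n : ℕ} {G : Graph n} (T : RootedSpanningTree G) where

  -- a is an ancestor of v in T (v is its own ancestor); equivalently v ∈ a↓
  Anc : Fin n → Fin n → Set
  Anc a v = ∃ λ k → iter (parent T) v k ≡ a

  SAnc : Fin n → Fin n → Set
  SAnc a v = Anc a v × a ≢ v

  IsLCA : Fin n → Fin n → Fin n → Set
  IsLCA a b c = Anc c a × Anc c b × (∀ d → Anc d a → Anc d b → Anc d c)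

  OnPath : Fin n → Fin n → Fin n → Set
  OnPath a b x = ∃ λ c → IsLCA a b c × (Anc x a ⊎ Anc x b) × Anc c x

  -- cuts are identified with the side not containing the root
  IsCut : Subset n → Set
  IsCut S = Nonempty S × root T ∉ S

  IsMincut : Subset n → Set
  IsMincut S = IsCut S × (∀ S' → IsCut S' → cutWeight G S ≤ℚ cutWeight G S')

  Represents : Subset n → (Fin n → Set) → Set
  Represents S P = ∀ x → (x ∈ S) ⇔ P x

  DiffDesc : Fin n → Fin n → Fin n → Set
  DiffDesc w v x = Anc w x × ¬ Anc v x

  IsMincutSet : (Fin n → Set) → Set
  IsMincutSet P = ∃ λ S → Represents S P × IsMincut S

  IsMinimalMincutOf : Fin n → Fin n → Subset n → Set
  IsMinimalMincutOf a b S =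
    IsMincut S × a ∈ S × b ∈ S ×
    (∀ S' → IsMincut S' → a ∈ S' → b ∈ S' → ∣ S ∣ ℕ.≤ ∣ S' ∣)

  -- H(v) = w  (H(v) is non-null and equals w): w is the highest strict
  -- ancestor of v such that w↓ ∖ v↓ is a mincut
  IsH : Fin n → Fin n → Set
  IsH v w = SAnc w v × IsMincutSet (DiffDesc w v) ×
    (∀ w' → SAnc w' v → IsMincutSet (DiffDesc w' v) → Anc w w')

  InL : Fin n → Fin n → Set
  InL u v = SAnc u v × ∃ λ w → IsH v w × Anc w u

  InTop : (Fin n → Set) → Fin n → Set
  InTop P v = P v × (∀ w → SAnc w v → ¬ P w)

  InY : Fin n → Fin n → Fin n → Fin n → Fin n → Set
  InY u₁ u₂ lca u x = OnPath u₁ u₂ x ⊎ OnPath u lca x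

{-# OPTIONS --safe #-}
-- Take v ∈ L_u ∖ Y_{e,u} and w = H(v), an ancestor of u, so that A = w↓ ∖ v↓ is a
-- mincut. Since v ∉ Y_{e,u}, v is an ancestor of neither endpoint of e, so both
-- endpoints lie in A. By submodularity of the cut function the minimal mincut of e
-- is contained in every mincut containing both endpoints, hence in A. But v lies
-- in the minimal mincut uₑ↓ ∖ lₑ↓, because u is strictly below xₑ on the path to
-- lcaₑ, while v ∉ A. So L_u ∖ Y_{e,u} is empty, and in particular so is its top.
module Submission where

open import Defs
open import Algebra.Bundles using (CommutativeMonoid)
open import Data.Bool using (Bool; true; false; _xor_; if_then_else_; _∧_; _∨_)
open import Data.Fin using (Fin)
open import Data.Fin.Subset using (Subset; _∈_; _∉_; _⊆_; _∩_; _∪_; Nonempty)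
open import Data.Fin.Subset.Properties
  using (_∈?_; x∈p∩q⁺; x∈p∪q⁻; p∩q⊆p; p∩q⊆q; p⊆p∪q; p⊂q⇒∣p∣<∣q∣)
open import Data.List using (List; []; _∷_; foldr)
open import Data.List.Membership.Propositional using () renaming (_∈_ to _∈ₗ_)
open import Data.List.Relation.Unary.Any using (here; there)
open import Data.Nat using (ℕ; zero; suc; _+_; _*_; _∸_; _≤_)
open import Data.Nat.Properties using (≤-total; m∸n+n≡m; *-suc; +-suc; +-comm; <⇒≱)
open import Data.Product using (_×_; _,_; proj₁; proj₂)
open import Data.Rational using (ℚ; 0ℚ; -_) renaming (_+_ to _+ℚ_; _≤_ to _≤ℚ_)
import Data.Rational.Properties as ℚ
open import Data.Sum using (_⊎_; inj₁; inj₂; [_,_]′)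
open import Data.Vec using (lookup)
open import Data.Vec.Properties using (lookup-zipWith)
open import Function using (_∘_; Equivalence)
open import Relation.Binary.PropositionalEquality
  using (_≡_; _≢_; refl; sym; trans; cong; cong₂; subst₂; module ≡-Reasoning)
open import Relation.Nullary using (¬_; yes; no; contradiction)

open import Algebra.Properties.CommutativeSemigroup
  (CommutativeMonoid.commutativeSemigroup ℚ.+-0-commutativeMonoid) using (interchange)
open import Algebra.Properties.Group ℚ.+-0-group using (//-rightDividesʳ)

iter-+ : ∀ {A : Set} (f : A → A) x i j → iter f x (i + j) ≡ iter f (iter f x j) i
iter-+ f x zero    j = refl
iter-+ f x (suc i) j = cong f (iter-+ f x i j)

iter-fixedPoint : ∀ {A : Set} (f : A → A) {x} → f x ≡ x → ∀ k → iter f x k ≡ x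
iter-fixedPoint f fx≡x zero    = refl
iter-fixedPoint f fx≡x (suc k) = trans (cong f (iter-fixedPoint f fx≡x k)) fx≡x

iter-periodic : ∀ {A : Set} (f : A → A) {x} m → iter f x m ≡ x → ∀ t → iter f x (t * m) ≡ x
iter-periodic f m fᵐx≡x zero    = refl
iter-periodic f {x} m fᵐx≡x (suc t) = begin
  iter f x (m + t * m)           ≡⟨ iter-+ f x m (t * m) ⟩
  iter f (iter f x (t * m)) m    ≡⟨ cong (λ y → iter f y m) (iter-periodic f m fᵐx≡x t) ⟩
  iter f x m                     ≡⟨ fᵐx≡x ⟩
  x                              ∎
  where open ≡-Reasoning

module _ {n : ℕ} {G : Graph n} (T : RootedSpanningTree G) where

  private
    p = parent T

  Anc-refl : ∀ a → Anc T a a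
  Anc-refl a = 0 , refl

  Anc-trans : ∀ {a b c} → Anc T a b → Anc T b c → Anc T a c
  Anc-trans {c = c} (i , cᵢ≡b) (j , bⱼ≡a) =
    i + j , trans (iter-+ p c i j) (trans (cong (λ y → iter p y i) bⱼ≡a) cᵢ≡b)

  iter-≤⇒Anc : ∀ {x a b i j} → i ≤ j → iter p x i ≡ a → iter p x j ≡ b → Anc T b a
  iter-≤⇒Anc {x} {a} {b} {i} {j} i≤j xᵢ≡a xⱼ≡b = j ∸ i , (begin
    iter p a (j ∸ i)               ≡⟨ cong (λ y → iter p y (j ∸ i)) xᵢ≡a ⟨
    iter p (iter p x i) (j ∸ i)    ≡⟨ iter-+ p x (j ∸ i) i ⟨
    iter p x (j ∸ i + i)           ≡⟨ cong (iter p x) (m∸n+n≡m i≤j) ⟩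
    iter p x j                     ≡⟨ xⱼ≡b ⟩
    b                              ∎)
    where open ≡-Reasoning

  Anc-comparable : ∀ {a b x} → Anc T a x → Anc T b x → Anc T a b ⊎ Anc T b a
  Anc-comparable (i , xᵢ≡a) (j , xⱼ≡b) with ≤-total i j
  ... | inj₁ i≤j = inj₂ (iter-≤⇒Anc i≤j xᵢ≡a xⱼ≡b)
  ... | inj₂ j≤i = inj₁ (iter-≤⇒Anc j≤i xⱼ≡b xᵢ≡a)

  parent-cycle⇒root : ∀ {b} l → iter p b (suc l) ≡ b → b ≡ root T
  parent-cycle⇒root {b} l cycle = begin
    b                             ≡⟨ iter-periodic p (suc l) cycle k ⟨
    iter p b (k * suc l)          ≡⟨ cong (iter p b) (trans (*-suc k l) (+-comm k (k * l))) ⟩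
    iter p b (k * l + k)          ≡⟨ iter-+ p b (k * l) k ⟩
    iter p (iter p b k) (k * l)   ≡⟨ cong (λ y → iter p y (k * l)) bₖ≡root ⟩
    iter p (root T) (k * l)       ≡⟨ iter-fixedPoint p (parent-root T) (k * l) ⟩
    root T                        ∎
    where
    open ≡-Reasoning
    k = proj₁ (reaches-root T b)
    bₖ≡root = proj₂ (reaches-root T b)

  Anc-antisym : ∀ {a b} → Anc T a b → Anc T b a → a ≡ b
  Anc-antisym (zero , b≡a) _ = sym b≡a
  Anc-antisym {a} {b} (suc i , bᵢ≡a) (j , aⱼ≡b) = trans a≡root (sym b≡root)
    where
    b≡root : b ≡ root T
    b≡root = parent-cycle⇒root (j + i) (begin
      iter p b (suc (j + i))          ≡⟨ cong (iter p b) (+-suc j i) ⟨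
      iter p b (j + suc i)            ≡⟨ iter-+ p b j (suc i) ⟩
      iter p (iter p b (suc i)) j     ≡⟨ cong (λ y → iter p y j) bᵢ≡a ⟩
      iter p a j                      ≡⟨ aⱼ≡b ⟩
      b                               ∎)
      where open ≡-Reasoning
    a≡root : a ≡ root T
    a≡root = trans (sym bᵢ≡a)
      (trans (cong (λ y → iter p y (suc i)) b≡root) (iter-fixedPoint p (parent-root T) (suc i)))

  IsLCA-of-Anc : ∀ {a b} → Anc T a b → IsLCA T a b a
  IsLCA-of-Anc {a} a≥b = Anc-refl a , a≥b , λ _ d≥a _ → d≥a

  OnPath-of-between : ∀ {a b x} → Anc T a b → Anc T a x → Anc T x b → OnPath T a b x
  OnPath-of-between {a} a≥b a≥x x≥b = a , IsLCA-of-Anc a≥b , inj₂ x≥b , a≥x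

  OnPath-of-Anc : ∀ {a b x} → Anc T a b → OnPath T a b x → Anc T a x × Anc T x b
  OnPath-of-Anc {a} a≥b (c , (_ , _ , c-greatest) , x≥a⊎x≥b , c≥x) =
    Anc-trans (c-greatest a (Anc-refl a) a≥b) c≥x ,
    [ (λ x≥a → Anc-trans x≥a a≥b) , (λ x≥b → x≥b) ]′ x≥a⊎x≥b

  Anc-endpoint⇒InY : ∀ {u₁ u₂ lca u v} → IsLCA T u₁ u₂ lca → Anc T u lca → Anc T u v →
    Anc T v u₁ ⊎ Anc T v u₂ → InY T u₁ u₂ lca u v
  Anc-endpoint⇒InY lca-is@(lca≥u₁ , lca≥u₂ , _) u≥lca u≥v v≥endpoint
    with [ (λ v≥u₁ → Anc-comparable v≥u₁ lca≥u₁) , (λ v≥u₂ → Anc-comparable v≥u₂ lca≥u₂) ]′ v≥endpoint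
  ... | inj₁ v≥lca = inj₂ (OnPath-of-between u≥lca u≥v v≥lca)
  ... | inj₂ lca≥v = inj₁ (_ , lca-is , v≥endpoint , lca≥v)

  below-LCA⇒¬Anc : ∀ {l c x u v} → IsLCA T l c x → Anc T x u → Anc T u c → u ≢ x →
    ¬ Anc T l c → Anc T u v → ¬ Anc T l v
  below-LCA⇒¬Anc (_ , _ , x-greatest) x≥u u≥c u≢x l≱c u≥v l≥v with Anc-comparable l≥v u≥v
  ... | inj₁ l≥u = l≱c (Anc-trans l≥u u≥c)
  ... | inj₂ u≥l = u≢x (Anc-antisym (x-greatest _ u≥l u≥c) x≥u)

addIf : Bool → ℚ → ℚ → ℚ
addIf β c x = if β then c +ℚ x else x

weigh : Bool → ℚ → ℚ
weigh β c = if β then c else 0ℚ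

addIf-weigh : ∀ β c x → addIf β c x ≡ weigh β c +ℚ x
addIf-weigh true  c x = refl
addIf-weigh false c x = sym (ℚ.+-identityˡ x)

crossing-submodular : ∀ a b s t {c} → 0ℚ ≤ℚ c →
  weigh ((a ∧ s) xor (b ∧ t)) c +ℚ weigh ((a ∨ s) xor (b ∨ t)) c ≤ℚ
  weigh (a xor b) c +ℚ weigh (s xor t) c
crossing-submodular false false false false     _   = ℚ.≤-refl
crossing-submodular false false false true      _   = ℚ.≤-refl
crossing-submodular false false true  false     _   = ℚ.≤-refl
crossing-submodular false false true  true      _   = ℚ.≤-refl
crossing-submodular false true  false false {c} _   = ℚ.≤-reflexive (ℚ.+-comm 0ℚ c)
crossing-submodular false true  false true      _   = ℚ.≤-refl
crossing-submodular false true  true  false     c≥0 = ℚ.+-mono-≤ c≥0 c≥0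
crossing-submodular false true  true  true      _   = ℚ.≤-refl
crossing-submodular true  false false false {c} _   = ℚ.≤-reflexive (ℚ.+-comm 0ℚ c)
crossing-submodular true  false false true      c≥0 = ℚ.+-mono-≤ c≥0 c≥0
crossing-submodular true  false true  false     _   = ℚ.≤-refl
crossing-submodular true  false true  true      _   = ℚ.≤-refl
crossing-submodular true  true  false false     _   = ℚ.≤-refl
crossing-submodular true  true  false true  {c} _   = ℚ.≤-reflexive (ℚ.+-comm c 0ℚ)
crossing-submodular true  true  true  false {c} _   = ℚ.≤-reflexive (ℚ.+-comm c 0ℚ)
crossing-submodular true  true  true  true      _   = ℚ.≤-refl

addIf-pair : ∀ β γ c x y → addIf β c x +ℚ addIf γ c y ≡ (weigh β c +ℚ weigh γ c) +ℚ (x +ℚ y)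
addIf-pair β γ c x y =
  trans (cong₂ _+ℚ_ (addIf-weigh β c x) (addIf-weigh γ c y)) (interchange (weigh β c) x (weigh γ c) y)

addIf-submodular : ∀ a b s t {c x y z w} → 0ℚ ≤ℚ c → x +ℚ y ≤ℚ z +ℚ w →
  addIf ((a ∧ s) xor (b ∧ t)) c x +ℚ addIf ((a ∨ s) xor (b ∨ t)) c y ≤ℚ
  addIf (a xor b) c z +ℚ addIf (s xor t) c w
addIf-submodular a b s t {c} {x} {y} {z} {w} c≥0 x+y≤z+w =
  subst₂ _≤ℚ_ (sym (addIf-pair ((a ∧ s) xor (b ∧ t)) ((a ∨ s) xor (b ∨ t)) c x y))
              (sym (addIf-pair (a xor b) (s xor t) c z w))
              (ℚ.+-mono-≤ (crossing-submodular a b s t c≥0) x+y≤z+w)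

module _ {n : ℕ} where

  Edge : Set
  Edge = (Fin n × Fin n) × ℚ

  -- cutWeight G S unfolds definitionally to cutWeightOf S (edges G).
  cutWeightOf : Subset n → List Edge → ℚ
  cutWeightOf S = foldr (λ { ((a , b) , c) → addIf (lookup S a xor lookup S b) c }) 0ℚ

  cutWeightOf-submodular : ∀ A S (es : List Edge) → (∀ {e} → e ∈ₗ es → 0ℚ ≤ℚ proj₂ e) →
    cutWeightOf (A ∩ S) es +ℚ cutWeightOf (A ∪ S) es ≤ℚ cutWeightOf A es +ℚ cutWeightOf S es
  cutWeightOf-submodular A S [] _ = ℚ.≤-refl
  cutWeightOf-submodular A S (((a , b) , c) ∷ es) nonNeg
    rewrite lookup-zipWith _∧_ a A S | lookup-zipWith _∧_ b A S
          | lookup-zipWith _∨_ a A S | lookup-zipWith _∨_ b A S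
    = addIf-submodular (lookup A a) (lookup A b) (lookup S a) (lookup S b) (nonNeg (here refl))
        (cutWeightOf-submodular A S es (nonNeg ∘ there))

  cutWeight-submodular : ∀ (G : Graph n) A S →
    cutWeight G (A ∩ S) +ℚ cutWeight G (A ∪ S) ≤ℚ cutWeight G A +ℚ cutWeight G S
  cutWeight-submodular G A S = cutWeightOf-submodular A S (edges G) (weight≥0 G)

+-cancelʳ-≤ : ∀ r {p q} → p +ℚ r ≤ℚ q +ℚ r → p ≤ℚ q
+-cancelʳ-≤ r {p} {q} p+r≤q+r =
  subst₂ _≤ℚ_ (//-rightDividesʳ r p) (//-rightDividesʳ r q) (ℚ.+-monoˡ-≤ (- r) p+r≤q+r)

module _ {n : ℕ} {G : Graph n} (T : RootedSpanningTree G) where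

  Represents⇒∈ : ∀ {S P x} → Represents T S P → x ∈ S → P x
  Represents⇒∈ S≡P = Equivalence.to (S≡P _)

  Represents⇐∈ : ∀ {S P x} → Represents T S P → P x → x ∈ S
  Represents⇐∈ S≡P = Equivalence.from (S≡P _)

  ∪-isCut : ∀ {A S} → IsCut T A → IsCut T S → IsCut T (A ∪ S)
  ∪-isCut {A} {S} ((a , a∈A) , r∉A) (_ , r∉S) =
    (a , p⊆p∪q S a∈A) , λ r∈A∪S → [ r∉A , r∉S ]′ (x∈p∪q⁻ A S r∈A∪S)

  ∩-isMincut : ∀ {A S} → IsMincut T A → IsMincut T S → Nonempty (A ∩ S) → IsMincut T (A ∩ S)
  ∩-isMincut {A} {S} (A-cut , A-min) (S-cut , S-min) A∩S-nonempty =
    (A∩S-nonempty , proj₂ A-cut ∘ p∩q⊆p A S) ,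
    λ S' S'-cut → ℚ.≤-trans wA∩S≤wA (A-min S' S'-cut)
    where
    wA∩S≤wA : cutWeight G (A ∩ S) ≤ℚ cutWeight G A
    wA∩S≤wA = +-cancelʳ-≤ (cutWeight G S) (ℚ.≤-trans
      (ℚ.+-monoʳ-≤ (cutWeight G (A ∩ S)) (S-min (A ∪ S) (∪-isCut A-cut S-cut)))
      (cutWeight-submodular G A S))

  minimalMincut-⊆ : ∀ {a b S A} → IsMinimalMincutOf T a b S →
    IsMincut T A → a ∈ A → b ∈ A → S ⊆ A
  minimalMincut-⊆ {a} {S = S} {A} (S-min , a∈S , b∈S , S-least) A-min a∈A b∈A {x} x∈S
    with x ∈? A
  ... | yes x∈A = x∈A
  ... | no  x∉A = contradiction
    (S-least (A ∩ S) (∩-isMincut A-min S-min (a , a∈A∩S)) a∈A∩S (x∈p∩q⁺ (b∈A , b∈S)))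
    (<⇒≱ (p⊂q⇒∣p∣<∣q∣ (p∩q⊆q A S , x , x∈S , x∉A ∘ p∩q⊆p A S)))
    where
    a∈A∩S = x∈p∩q⁺ (a∈A , a∈S)

corollary5p10 : {n : ℕ} (G : Graph n) (T : RootedSpanningTree G)
    (u₁ u₂ uₑ lₑ lcaₑ xₑ : Fin n) (Sₑ : Subset n) →
    IsEdge G u₁ u₂ →
    SAnc T uₑ lₑ →
    Represents T Sₑ (DiffDesc T uₑ lₑ) →
    IsMinimalMincutOf T u₁ u₂ Sₑ →
    IsLCA T u₁ u₂ lcaₑ →
    IsLCA T lₑ lcaₑ xₑ →
    (u : Fin n) → OnPath T xₑ lcaₑ u → u ≢ xₑ →
    (v : Fin n) → ¬ InTop T (λ y → InL T u y × ¬ InY T u₁ u₂ lcaₑ u y) v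
corollary5p10 G T u₁ u₂ uₑ lₑ lcaₑ xₑ Sₑ _ (uₑ≥lₑ , _) Sₑ≡ Sₑ-minimal@(_ , u₁∈Sₑ , u₂∈Sₑ , _)
  lcaₑ-is@(lcaₑ≥u₁ , lcaₑ≥u₂ , lcaₑ-greatest) xₑ-is@(_ , xₑ≥lcaₑ , xₑ-greatest) u u∈path u≢xₑ v
  ((((u≥v , _) , w , (_ , (A , A≡ , A-mincut) , _) , w≥u) , v∉Y) , _) =
  v∉A (minimalMincut-⊆ T Sₑ-minimal A-mincut (endpoint∈A inj₁ lcaₑ≥u₁) (endpoint∈A inj₂ lcaₑ≥u₂) v∈Sₑ)
  where
  xₑ≥u = proj₁ (OnPath-of-Anc T xₑ≥lcaₑ u∈path)
  u≥lcaₑ = proj₂ (OnPath-of-Anc T xₑ≥lcaₑ u∈path)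

  v∉A : v ∉ A
  v∉A v∈A = proj₂ (Represents⇒∈ T A≡ v∈A) (Anc-refl T v)

  endpoint∈A : ∀ {z} → (Anc T v z → Anc T v u₁ ⊎ Anc T v u₂) → Anc T lcaₑ z → z ∈ A
  endpoint∈A v≥z⇒v≥endpoint lcaₑ≥z = Represents⇐∈ T A≡
    ( Anc-trans T w≥u (Anc-trans T u≥lcaₑ lcaₑ≥z)
    , v∉Y ∘ Anc-endpoint⇒InY T lcaₑ-is u≥lcaₑ u≥v ∘ v≥z⇒v≥endpoint )

  uₑ≥xₑ : Anc T uₑ xₑ
  uₑ≥xₑ = xₑ-greatest uₑ uₑ≥lₑ (lcaₑ-greatest uₑ (proj₁ (Represents⇒∈ T Sₑ≡ u₁∈Sₑ))
                                                (proj₁ (Represents⇒∈ T Sₑ≡ u₂∈Sₑ)))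

  lₑ≱lcaₑ : ¬ Anc T lₑ lcaₑ
  lₑ≱lcaₑ lₑ≥lcaₑ = proj₂ (Represents⇒∈ T Sₑ≡ u₁∈Sₑ) (Anc-trans T lₑ≥lcaₑ lcaₑ≥u₁)

  v∈Sₑ : v ∈ Sₑ
  v∈Sₑ = Represents⇐∈ T Sₑ≡
    ( Anc-trans T uₑ≥xₑ (Anc-trans T xₑ≥u u≥v)
    , below-LCA⇒¬Anc T xₑ-is xₑ≥u u≥lcaₑ u≢xₑ lₑ≱lcaₑ u≥v )
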